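{- Let $n_1,n_2,n_3\ge 2$ and let $u,v$ be two distinct vertices of $P_{n_1}\Box P_{n_2}\Box P_{n_3}$. Then there are at least $\alpha_M(n_1,n_2,n_3)$ vertices in $F(n_1,n_2,n_3)$ resolving $u$ and $v$.
   Context: $P_{n_1}\Box P_{n_2}\Box P_{n_3}$ is the grid graph with vertex set $\{(x_1,x_2,x_3): 0\le x_i\le n_i-1\}$, two vertices adjacent iff they differ by exactly $1$ in exactly one coordinate; $d(x,y)=\sum_i|x_i-y_i|$. A vertex $w$ resolves $u,v$ if $d(w,u)\ne d(w,v)$. $F(n_1,n_2,n_3)=\{(x_1,x_2,x_3): x_i\in\{0,n_i-1\}\text{ for some }i\}$. $\alpha_M(n_1,n_2,n_3)=\min\{n_1(n_2+n_3-2),n_2(n_1+n_3-2),n_3(n_1+n_2-2)\}$. -}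

module Defs where

open import Data.Nat using (ℕ; _+_; _*_; _∸_; _⊓_; ∣_-_∣)
open import Data.Nat.Properties using (_≟_)
open import Data.Fin using (Fin; toℕ)
open import Data.Product using (_×_; _,_)
open import Data.Sum using (_⊎_)
open import Data.List using (List; allFin; cartesianProduct; filter; length)
open import Relation.Binary.PropositionalEquality using (_≡_)
open import Relation.Nullary using (¬_; Dec)
open import Relation.Nullary.Decidable using (_⊎-dec_; ¬?)

Vertex : ℕ → ℕ → ℕ → Set
Vertex n₁ n₂ n₃ = Fin n₁ × Fin n₂ × Fin n₃

dist : ∀ {n₁ n₂ n₃} → Vertex n₁ n₂ n₃ → Vertex n₁ n₂ n₃ → ℕ
dist (x₁ , x₂ , x₃) (y₁ , y₂ , y₃) =
  ∣ toℕ x₁ - toℕ y₁ ∣ + ∣ toℕ x₂ - toℕ y₂ ∣ + ∣ toℕ x₃ - toℕ y₃ ∣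

Resolves : ∀ {n₁ n₂ n₃} → Vertex n₁ n₂ n₃ → Vertex n₁ n₂ n₃ → Vertex n₁ n₂ n₃ → Set
Resolves w u v = ¬ (dist w u ≡ dist w v)

resolves? : ∀ {n₁ n₂ n₃} (u v w : Vertex n₁ n₂ n₃) → Dec (Resolves w u v)
resolves? u v w = ¬? (dist w u ≟ dist w v)

atEnd : ∀ {n} → Fin n → Set
atEnd {n} x = (toℕ x ≡ 0) ⊎ (toℕ x ≡ n ∸ 1)

atEnd? : ∀ {n} (x : Fin n) → Dec (atEnd x)
atEnd? {n} x = (toℕ x ≟ 0) ⊎-dec (toℕ x ≟ n ∸ 1)

InF : ∀ {n₁ n₂ n₃} → Vertex n₁ n₂ n₃ → Set
InF (x₁ , x₂ , x₃) = atEnd x₁ ⊎ atEnd x₂ ⊎ atEnd x₃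

InF? : ∀ {n₁ n₂ n₃} (x : Vertex n₁ n₂ n₃) → Dec (InF x)
InF? (x₁ , x₂ , x₃) = atEnd? x₁ ⊎-dec (atEnd? x₂ ⊎-dec atEnd? x₃)

vertices : ∀ n₁ n₂ n₃ → List (Vertex n₁ n₂ n₃)
vertices n₁ n₂ n₃ =
  cartesianProduct (allFin n₁) (cartesianProduct (allFin n₂) (allFin n₃))

numResolvingInF : ∀ {n₁ n₂ n₃} → Vertex n₁ n₂ n₃ → Vertex n₁ n₂ n₃ → ℕ
numResolvingInF {n₁} {n₂} {n₃} u v =
  length (filter (λ w → InF? w) (filter (resolves? u v) (vertices n₁ n₂ n₃)))

αM : ℕ → ℕ → ℕ → ℕ
αM n₁ n₂ n₃ =
  ((n₁ * (n₂ + n₃ ∸ 2)) ⊓ (n₂ * (n₁ + n₃ ∸ 2))) ⊓ (n₃ * (n₁ + n₂ ∸ 2))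

-- Write n₂ = b + 2 and n₃ = c + 2. In each slice x₁ = t, pair each of the n₃ vertices with
-- x₂ = 0 with its mirror image across the middle of P_{n₂}, and each of the b vertices with
-- x₃ = 0 and 0 < x₂ < n₂ - 1 with its mirror image across the middle of P_{n₃}; this gives
-- n₁ (n₂ + n₃ - 2) disjoint pairs of vertices of F. If u and v differ in coordinates 2 and 3,
-- a vertex and its mirror image cannot both fail to resolve them: the two distances to u
-- differ by 2u₂ - (n₂ - 1) (or 2u₃ - (n₃ - 1)), and likewise for v. If u and v differ only
-- in coordinate 1, move the mirror image to the slice s(t) for a fixed-point-free
-- permutation s: a slice fails to resolve u and v only if it is the midpoint slice, and
-- t ≠ s(t). Either way one vertex per pair resolves. Every other pair of distinct vertices
-- falls into one of these two cases after cyclically permuting the coordinates, which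
-- yields the other two terms of α_M.
module Submission where

open import Defs
open import Data.Fin using (Fin; zero; suc; toℕ; fromℕ; fromℕ<; inject₁)
open import Data.Fin.Properties
  using (toℕ-fromℕ; toℕ-fromℕ<; toℕ-injective; toℕ≤pred[n]; suc-injective; fromℕ≢inject₁;
         inject₁-injective; 0≢1+n; *↔×; +↔⊎; injective⇒≤)
  renaming (_≟_ to _≟ᶠ_)
open import Data.List using (List; length; filter)
open import Data.List.Membership.Propositional using (_∈_)
open import Data.List.Membership.Propositional.Properties
  using (∈-filter⁺; ∈-cartesianProduct⁺; ∈-allFin)
import Data.List.Membership.Setoid.Properties as SetoidMembership
open import Data.Nat using (ℕ; suc; _+_; _*_; _∸_; ∣_-_∣; _≤_; _<_; s≤s; z<s)
open import Data.Nat.Properties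
  using (_≟_; _<?_; ≤-total; ≤-trans; ≤-reflexive; ≤-antisym; ≮⇒≥; <-cmp; <-irrefl; +-comm;
         +-cancelˡ-≡; +-cancelʳ-≡; +-cancelʳ-≤; +-monoʳ-≤; +-mono-<; ∸-monoʳ-≤; m+[n∸m]≡n;
         m≤n⇒∣m-n∣≡n∸m; m≤n⇒∣n-m∣≡n∸m; 1+n≢n; m⊓n≤m; m⊓n≤n; +-commutativeSemigroup)
open import Algebra.Properties.CommutativeSemigroup +-commutativeSemigroup
  using (x∙yz≈y∙xz; xy∙z≈xz∙y; xy∙z≈zx∙y)
open import Data.Product using (_×_; _,_; proj₁; proj₂)
open import Data.Product.Function.NonDependent.Propositional using (_×-↔_)
open import Data.Sum using (_⊎_; inj₁; inj₂)
open import Function using (_↣_; Injection; Injective)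
open import Function.Construct.Composition using (_↔-∘_)
open import Function.Properties.Inverse using (↔-refl; ↔⇒↣)
open import Relation.Binary using (tri<; tri≈; tri>)
open import Relation.Binary.PropositionalEquality
  using (_≡_; _≢_; refl; sym; trans; cong; cong₂; setoid; module ≡-Reasoning)
open import Relation.Nullary using (¬_; yes; no; contradiction)

open ≡-Reasoning

record InjectiveFamily {A : Set} (I : Set) (P : A → Set) : Set where
  constructor injectiveFamily
  field
    member           : I → A
    member-injective : Injective _≡_ _≡_ member
    member-satisfies : ∀ i → P (member i)

module _ {A : Set} {P : A → Set} where

  family-reindex : ∀ {I J} → J ↣ I → InjectiveFamily I P → InjectiveFamily J P
  family-reindex e (injectiveFamily h h-injective h-P) = injectiveFamily
    (λ j → h (Injection.to e j)) (λ eq → Injection.injective e (h-injective eq))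
    (λ j → h-P (Injection.to e j))

  family-map : ∀ {I B} {Q : B → Set} (r : A → B) → Injective _≡_ _≡_ r →
               (∀ {a} → P a → Q (r a)) → InjectiveFamily I P → InjectiveFamily I Q
  family-map r r-injective P⇒Q (injectiveFamily h h-injective h-P) = injectiveFamily
    (λ i → r (h i)) (λ eq → h-injective (r-injective eq)) (λ i → P⇒Q (h-P i))

  family-≤-length : ∀ {n} {xs : List A} → (∀ {a} → P a → a ∈ xs) →
                    InjectiveFamily (Fin n) P → n ≤ length xs
  family-≤-length P⇒∈ (injectiveFamily h h-injective h-P) =
    injective⇒≤ (λ eq → h-injective
      (SetoidMembership.index-injective (setoid A) (P⇒∈ (h-P _)) (P⇒∈ (h-P _)) eq))

  module _ {I : Set} {f g : I → A} (f-injective : Injective _≡_ _≡_ f)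
           (g-injective : Injective _≡_ _≡_ g) (f≢g : ∀ i j → f i ≢ g j) where

    private
      pick : ∀ {i} → P (f i) ⊎ P (g i) → A
      pick {i} (inj₁ _) = f i
      pick {i} (inj₂ _) = g i

      pick-injective : ∀ {i j} (p : P (f i) ⊎ P (g i)) (q : P (f j) ⊎ P (g j)) →
                       pick p ≡ pick q → i ≡ j
      pick-injective (inj₁ _) (inj₁ _) eq = f-injective eq
      pick-injective (inj₁ _) (inj₂ _) eq = contradiction eq (f≢g _ _)
      pick-injective (inj₂ _) (inj₁ _) eq = contradiction (sym eq) (f≢g _ _)
      pick-injective (inj₂ _) (inj₂ _) eq = g-injective eq

      pick-satisfies : ∀ {i} (p : P (f i) ⊎ P (g i)) → P (pick p)
      pick-satisfies (inj₁ Pf) = Pf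
      pick-satisfies (inj₂ Pg) = Pg

    pairing-family : (∀ i → P (f i) ⊎ P (g i)) → InjectiveFamily I P
    pairing-family choice = injectiveFamily
      (λ i → pick (choice i)) (λ {i} {j} → pick-injective (choice i) (choice j))
      (λ i → pick-satisfies (choice i))

ResolvingInF : ∀ {n₁ n₂ n₃} → Vertex n₁ n₂ n₃ → Vertex n₁ n₂ n₃ → Vertex n₁ n₂ n₃ → Set
ResolvingInF u v w = Resolves w u v × InF w

∈-vertices : ∀ {n₁ n₂ n₃} (w : Vertex n₁ n₂ n₃) → w ∈ vertices n₁ n₂ n₃
∈-vertices (w₁ , w₂ , w₃) =
  ∈-cartesianProduct⁺ (∈-allFin w₁) (∈-cartesianProduct⁺ (∈-allFin w₂) (∈-allFin w₃))

∈-resolvingInF : ∀ {n₁ n₂ n₃} {u v w : Vertex n₁ n₂ n₃} → ResolvingInF u v w →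
                 w ∈ filter InF? (filter (resolves? u v) (vertices n₁ n₂ n₃))
∈-resolvingInF {u = u} {v} {w} (resolves , inF) =
  ∈-filter⁺ InF? (∈-filter⁺ (resolves? u v) (∈-vertices w) resolves) inF

family-≤-numResolvingInF : ∀ {n₁ n₂ n₃ N} {u v : Vertex n₁ n₂ n₃} →
                           InjectiveFamily (Fin N) (ResolvingInF u v) → N ≤ numResolvingInF u v
family-≤-numResolvingInF = family-≤-length ∈-resolvingInF

+-double-injective : ∀ {m n} → m + m ≡ n + n → m ≡ n
+-double-injective {m} {n} eq with <-cmp m n
... | tri< m<n _ _ = contradiction (+-mono-< m<n m<n) (<-irrefl eq)
... | tri≈ _ m≡n _ = m≡n
... | tri> _ _ n<m = contradiction (+-mono-< n<m n<m) (<-irrefl (sym eq))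

-- With truncated subtraction o ∸ m antitone in m, no bounds m, n ≤ o are needed.
reflection-cancel : ∀ {p q m n} o → p + m ≡ q + n → p + (o ∸ m) ≡ q + (o ∸ n) → m ≡ n
reflection-cancel {p} {q} {m} {n} o eq eq′ =
  +-cancelˡ-≡ p m n (trans eq (cong (_+ n) (sym p≡q)))
  where
  offsets-equal : ∀ {p q m n} → m ≤ n → p + m ≡ q + n → p + (o ∸ m) ≡ q + (o ∸ n) → p ≡ q
  offsets-equal {p} {q} {m} {n} m≤n eq eq′ = ≤-antisym
    (+-cancelʳ-≤ (o ∸ m) p q (≤-trans (≤-reflexive eq′) (+-monoʳ-≤ q (∸-monoʳ-≤ o m≤n))))
    (+-cancelʳ-≤ n q p (≤-trans (≤-reflexive (sym eq)) (+-monoʳ-≤ p m≤n)))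
  p≡q : p ≡ q
  p≡q with ≤-total m n
  ... | inj₁ m≤n = offsets-equal m≤n eq eq′
  ... | inj₂ n≤m = sym (offsets-equal n≤m (sym eq) (sym eq′))

∣m-n∣-split : ∀ m n → n ≡ m + ∣ m - n ∣ ⊎ m ≡ n + ∣ m - n ∣
∣m-n∣-split m n with ≤-total m n
... | inj₁ m≤n = inj₁ (sym (trans (cong (m +_) (m≤n⇒∣m-n∣≡n∸m m≤n)) (m+[n∸m]≡n m≤n)))
... | inj₂ n≤m = inj₂ (sym (trans (cong (n +_) (m≤n⇒∣n-m∣≡n∸m n≤m)) (m+[n∸m]≡n n≤m)))

crossing⇒midpoint : ∀ {t a b d} → t ≡ a + d → b ≡ t + d → t + t ≡ a + b
crossing⇒midpoint {t} {a} {b} {d} t≡ b≡ = begin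
  t + t       ≡⟨ cong (t +_) t≡ ⟩
  t + (a + d) ≡⟨ x∙yz≈y∙xz t a d ⟩
  a + (t + d) ≡⟨ cong (a +_) b≡ ⟨
  a + b       ∎

equidistant⇒midpoint : ∀ t {u v} → u ≢ v → ∣ t - u ∣ ≡ ∣ t - v ∣ → t + t ≡ u + v
equidistant⇒midpoint t {u} {v} u≢v eq with ∣m-n∣-split t u | ∣m-n∣-split t v
... | inj₁ u≡ | inj₁ v≡ = contradiction (trans u≡ (trans (cong (t +_) eq) (sym v≡))) u≢v
... | inj₂ t≡ | inj₂ t≡′ =
  contradiction (+-cancelʳ-≡ _ u v (trans (sym t≡) (trans t≡′ (cong (v +_) (sym eq))))) u≢v
... | inj₁ u≡ | inj₂ t≡ = trans (crossing⇒midpoint t≡ (trans u≡ (cong (t +_) eq))) (+-comm v u)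
... | inj₂ t≡ | inj₁ v≡ = crossing⇒midpoint t≡ (trans v≡ (cong (t +_) (sym eq)))

equidistant-unique : ∀ s t {u v} → u ≢ v →
                     ∣ s - u ∣ ≡ ∣ s - v ∣ → ∣ t - u ∣ ≡ ∣ t - v ∣ → s ≡ t
equidistant-unique s t u≢v eqₛ eqₜ = +-double-injective
  (trans (equidistant⇒midpoint s u≢v eqₛ) (sym (equidistant⇒midpoint t u≢v eqₜ)))

top-reflection-cancel : ∀ {p q b} (x y : Fin (suc b)) → p + toℕ x ≡ q + toℕ y →
                        p + ∣ toℕ (fromℕ b) - toℕ x ∣ ≡ q + ∣ toℕ (fromℕ b) - toℕ y ∣ → x ≡ y
top-reflection-cancel {p} {q} {b} x y eq eq′ =
  toℕ-injective (reflection-cancel b eq (begin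
    p + (b ∸ toℕ x)             ≡⟨ cong (p +_) (distance-to-top x) ⟨
    p + ∣ toℕ (fromℕ b) - toℕ x ∣ ≡⟨ eq′ ⟩
    q + ∣ toℕ (fromℕ b) - toℕ y ∣ ≡⟨ cong (q +_) (distance-to-top y) ⟩
    q + (b ∸ toℕ y)             ∎))
  where
  distance-to-top : ∀ (z : Fin (suc b)) → ∣ toℕ (fromℕ b) - toℕ z ∣ ≡ b ∸ toℕ z
  distance-to-top z = trans (cong (∣_- toℕ z ∣) (toℕ-fromℕ b)) (m≤n⇒∣n-m∣≡n∸m (toℕ≤pred[n] z))

dist-swap₂₃ : ∀ {n₁ n₂ n₃} (w₁ x₁ : Fin n₁) (w₂ x₂ : Fin n₂) (w₃ x₃ : Fin n₃) →
              dist (w₁ , w₂ , w₃) (x₁ , x₂ , x₃) ≡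
              ∣ toℕ w₁ - toℕ x₁ ∣ + ∣ toℕ w₃ - toℕ x₃ ∣ + ∣ toℕ w₂ - toℕ x₂ ∣
dist-swap₂₃ w₁ x₁ w₂ x₂ w₃ x₃ =
  xy∙z≈xz∙y (∣ toℕ w₁ - toℕ x₁ ∣) (∣ toℕ w₂ - toℕ x₂ ∣) (∣ toℕ w₃ - toℕ x₃ ∣)

mirror₂ : ∀ {n₁ b n₃} (t : Fin n₁) (z : Fin n₃) (u v : Vertex n₁ (suc b) n₃) →
          dist (t , zero , z) u ≡ dist (t , zero , z) v →
          dist (t , fromℕ b , z) u ≡ dist (t , fromℕ b , z) v →
          proj₁ (proj₂ u) ≡ proj₁ (proj₂ v)
mirror₂ t z (u₁ , u₂ , u₃) (v₁ , v₂ , v₃) eq eq′ =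
  top-reflection-cancel u₂ v₂ (swapped zero eq) (swapped (fromℕ _) eq′)
  where
  swapped : ∀ x₂ → dist (t , x₂ , z) (u₁ , u₂ , u₃) ≡ dist (t , x₂ , z) (v₁ , v₂ , v₃) →
            ∣ toℕ t - toℕ u₁ ∣ + ∣ toℕ z - toℕ u₃ ∣ + ∣ toℕ x₂ - toℕ u₂ ∣ ≡
            ∣ toℕ t - toℕ v₁ ∣ + ∣ toℕ z - toℕ v₃ ∣ + ∣ toℕ x₂ - toℕ v₂ ∣
  swapped x₂ eq = trans (sym (dist-swap₂₃ t u₁ x₂ u₂ z u₃)) (trans eq (dist-swap₂₃ t v₁ x₂ v₂ z v₃))

mirror₃ : ∀ {n₁ n₂ c} (t : Fin n₁) (y : Fin n₂) (u v : Vertex n₁ n₂ (suc c)) →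
          dist (t , y , zero) u ≡ dist (t , y , zero) v →
          dist (t , y , fromℕ c) u ≡ dist (t , y , fromℕ c) v →
          proj₂ (proj₂ u) ≡ proj₂ (proj₂ v)
mirror₃ t y (u₁ , u₂ , u₃) (v₁ , v₂ , v₃) = top-reflection-cancel u₃ v₃

equidistant-first : ∀ {n₁ n₂ n₃} (w : Vertex n₁ n₂ n₃) (u₁ v₁ : Fin n₁) x₂ x₃ →
                    dist w (u₁ , x₂ , x₃) ≡ dist w (v₁ , x₂ , x₃) →
                    ∣ toℕ (proj₁ w) - toℕ u₁ ∣ ≡ ∣ toℕ (proj₁ w) - toℕ v₁ ∣
equidistant-first (w₁ , w₂ , w₃) u₁ v₁ x₂ x₃ eq = +-cancelʳ-≡ _ _ _ (+-cancelʳ-≡ _ _ _ eq)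

cyclicSuc : ∀ {n} → Fin (suc n) → Fin (suc n)
cyclicSuc {n} i with toℕ i <? n
... | yes i<n = suc (fromℕ< i<n)
... | no _    = zero

cyclicSuc-injective : ∀ {n} → Injective _≡_ _≡_ (cyclicSuc {n})
cyclicSuc-injective {n} {i} {j} eq with toℕ i <? n | toℕ j <? n
... | yes i<n | yes j<n = toℕ-injective (begin
  toℕ i                  ≡⟨ toℕ-fromℕ< i<n ⟨
  toℕ (fromℕ< i<n)       ≡⟨ cong toℕ (suc-injective eq) ⟩
  toℕ (fromℕ< j<n)       ≡⟨ toℕ-fromℕ< j<n ⟩
  toℕ j                  ∎)
... | no i≮n  | no j≮n  = toℕ-injective (trans (last i i≮n) (sym (last j j≮n)))
  where
  last : ∀ (k : Fin (suc n)) → ¬ toℕ k < n → toℕ k ≡ n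
  last k k≮n = ≤-antisym (toℕ≤pred[n] k) (≮⇒≥ k≮n)
cyclicSuc-injective {n} {i} {j} () | yes _ | no _
cyclicSuc-injective {n} {i} {j} () | no _  | yes _

cyclicSuc-fixedPointFree : ∀ {n} (i : Fin (suc (suc n))) → cyclicSuc i ≢ i
cyclicSuc-fixedPointFree {n} i with toℕ i <? suc n
... | yes i<n = λ eq → 1+n≢n (trans (cong suc (sym (toℕ-fromℕ< i<n))) (cong toℕ eq))
... | no i≮n  = λ { refl → i≮n z<s }

rotate : ∀ {n₁ n₂ n₃} → Vertex n₁ n₂ n₃ → Vertex n₂ n₃ n₁
rotate (x₁ , x₂ , x₃) = x₂ , x₃ , x₁

rotate-injective : ∀ {n₁ n₂ n₃} → Injective _≡_ _≡_ (rotate {n₁} {n₂} {n₃})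
rotate-injective {x = _ , _ , _} {y = _ , _ , _} refl = refl

dist-rotate : ∀ {n₁ n₂ n₃} (w x : Vertex n₁ n₂ n₃) → dist (rotate w) (rotate x) ≡ dist w x
dist-rotate (w₁ , w₂ , w₃) (x₁ , x₂ , x₃) =
  xy∙z≈zx∙y (∣ toℕ w₂ - toℕ x₂ ∣) (∣ toℕ w₃ - toℕ x₃ ∣) (∣ toℕ w₁ - toℕ x₁ ∣)

InF-rotate : ∀ {n₁ n₂ n₃} {w : Vertex n₁ n₂ n₃} → InF w → InF (rotate w)
InF-rotate {w = _ , _ , _} (inj₁ end₁)        = inj₂ (inj₂ end₁)
InF-rotate {w = _ , _ , _} (inj₂ (inj₁ end₂)) = inj₁ end₂
InF-rotate {w = _ , _ , _} (inj₂ (inj₂ end₃)) = inj₂ (inj₁ end₃)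

rotate-family : ∀ {I n₁ n₂ n₃} {u v : Vertex n₁ n₂ n₃} → InjectiveFamily I (ResolvingInF u v) →
                InjectiveFamily I (ResolvingInF (rotate u) (rotate v))
rotate-family {u = u} {v} = family-map rotate rotate-injective λ {w} (resolves , inF) →
  (λ eq → resolves (trans (sym (dist-rotate w u)) (trans eq (dist-rotate w v)))) , InF-rotate inF

pairCount : ℕ → ℕ → ℕ → ℕ
pairCount n₁ n₂ n₃ = n₁ * (n₂ + n₃ ∸ 2)

-- A boundary index is a middle row y (giving the points (1+y, 0) and (1+y, n₃-1)) or a
-- column z (giving (0, z) and (n₂-1, z)) of the rectangle P_{b+2} □ P_{c+2}.
module FacePairs {n₁ b c : ℕ} (s : Fin n₁ → Fin n₁) (s-injective : Injective _≡_ _≡_ s) where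

  Boundary : Set
  Boundary = Fin b ⊎ Fin (suc (suc c))

  Rectangle : Set
  Rectangle = Fin (suc (suc b)) × Fin (suc (suc c))

  lowerBoundary : Boundary → Rectangle
  lowerBoundary (inj₁ y) = suc (inject₁ y) , zero
  lowerBoundary (inj₂ z) = zero , z

  upperBoundary : Boundary → Rectangle
  upperBoundary (inj₁ y) = suc (inject₁ y) , fromℕ (suc c)
  upperBoundary (inj₂ z) = fromℕ (suc b) , z

  lowerBoundary-injective : Injective _≡_ _≡_ lowerBoundary
  lowerBoundary-injective {inj₁ _} {inj₁ _} eq =
    cong inj₁ (inject₁-injective (suc-injective (cong proj₁ eq)))
  lowerBoundary-injective {inj₂ _} {inj₂ _} refl = refl

  upperBoundary-injective : Injective _≡_ _≡_ upperBoundary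
  upperBoundary-injective {inj₁ _} {inj₁ _} eq =
    cong inj₁ (inject₁-injective (suc-injective (cong proj₁ eq)))
  upperBoundary-injective {inj₁ _} {inj₂ _} eq =
    contradiction (sym (suc-injective (cong proj₁ eq))) fromℕ≢inject₁
  upperBoundary-injective {inj₂ _} {inj₁ _} eq =
    contradiction (suc-injective (cong proj₁ eq)) fromℕ≢inject₁
  upperBoundary-injective {inj₂ _} {inj₂ _} eq = cong inj₂ (cong proj₂ eq)

  lowerBoundary≢upperBoundary : ∀ r r′ → lowerBoundary r ≢ upperBoundary r′
  lowerBoundary≢upperBoundary (inj₁ _) (inj₁ _) eq = 0≢1+n (cong proj₂ eq)
  lowerBoundary≢upperBoundary (inj₁ _) (inj₂ _) eq =
    fromℕ≢inject₁ (sym (suc-injective (cong proj₁ eq)))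
  lowerBoundary≢upperBoundary (inj₂ _) (inj₁ _) ()
  lowerBoundary≢upperBoundary (inj₂ _) (inj₂ _) ()

  Index : Set
  Index = Fin n₁ × Boundary

  index↣ : Fin (n₁ * (b + suc (suc c))) ↣ Index
  index↣ = ↔⇒↣ ((↔-refl ×-↔ +↔⊎) ↔-∘ *↔×)

  V : Set
  V = Vertex n₁ (suc (suc b)) (suc (suc c))

  lower upper : Index → V
  lower (t , r) = t , lowerBoundary r
  upper (t , r) = s t , upperBoundary r

  lower-injective : Injective _≡_ _≡_ lower
  lower-injective eq = cong₂ _,_ (cong proj₁ eq) (lowerBoundary-injective (cong proj₂ eq))

  upper-injective : Injective _≡_ _≡_ upper
  upper-injective eq =
    cong₂ _,_ (s-injective (cong proj₁ eq)) (upperBoundary-injective (cong proj₂ eq))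

  lower≢upper : ∀ i j → lower i ≢ upper j
  lower≢upper (_ , r) (_ , r′) eq = lowerBoundary≢upperBoundary r r′ (cong proj₂ eq)

  InF-lower : ∀ i → InF (lower i)
  InF-lower (_ , inj₁ _) = inj₂ (inj₂ (inj₁ refl))
  InF-lower (_ , inj₂ _) = inj₂ (inj₁ (inj₁ refl))

  InF-upper : ∀ i → InF (upper i)
  InF-upper (_ , inj₁ _) = inj₂ (inj₂ (inj₂ (toℕ-fromℕ (suc c))))
  InF-upper (_ , inj₂ _) = inj₂ (inj₁ (inj₂ (toℕ-fromℕ (suc b))))

  facePair-family : (u v : V) →
                    (∀ i → dist (lower i) u ≡ dist (lower i) v → Resolves (upper i) u v) →
                    InjectiveFamily (Fin (pairCount n₁ (suc (suc b)) (suc (suc c))))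
                                    (ResolvingInF u v)
  facePair-family u v upper-resolves = family-reindex index↣
    (pairing-family lower-injective upper-injective lower≢upper choice)
    where
    choice : ∀ i → ResolvingInF u v (lower i) ⊎ ResolvingInF u v (upper i)
    choice i with dist (lower i) u ≟ dist (lower i) v
    ... | yes equidistant = inj₂ (upper-resolves i equidistant , InF-upper i)
    ... | no resolves     = inj₁ (resolves , InF-lower i)

tailDiffers-family : ∀ {n₁ b c} (u v : Vertex n₁ (suc (suc b)) (suc (suc c))) →
                     proj₁ (proj₂ u) ≢ proj₁ (proj₂ v) → proj₂ (proj₂ u) ≢ proj₂ (proj₂ v) →
                     InjectiveFamily (Fin (pairCount n₁ (suc (suc b)) (suc (suc c))))
                                     (ResolvingInF u v)
tailDiffers-family u v u₂≢v₂ u₃≢v₃ = facePair-family u v upper-resolves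
  where
  open FacePairs (λ t → t) (λ eq → eq)
  upper-resolves : ∀ i → dist (lower i) u ≡ dist (lower i) v → Resolves (upper i) u v
  upper-resolves (t , inj₁ y) eq eq′ = u₃≢v₃ (mirror₃ t (suc (inject₁ y)) u v eq eq′)
  upper-resolves (t , inj₂ z) eq eq′ = u₂≢v₂ (mirror₂ t z u v eq eq′)

headDiffers-family : ∀ {a b c} (u₁ v₁ : Fin (suc (suc a))) (x₂ : Fin (suc (suc b)))
                     (x₃ : Fin (suc (suc c))) → u₁ ≢ v₁ →
                     InjectiveFamily (Fin (pairCount (suc (suc a)) (suc (suc b)) (suc (suc c))))
                                     (ResolvingInF (u₁ , x₂ , x₃) (v₁ , x₂ , x₃))
headDiffers-family u₁ v₁ x₂ x₃ u₁≢v₁ = facePair-family _ _ upper-resolves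
  where
  open FacePairs cyclicSuc cyclicSuc-injective
  upper-resolves : ∀ i → dist (lower i) (u₁ , x₂ , x₃) ≡ dist (lower i) (v₁ , x₂ , x₃) →
                   Resolves (upper i) (u₁ , x₂ , x₃) (v₁ , x₂ , x₃)
  upper-resolves i@(t , _) eq eq′ = cyclicSuc-fixedPointFree t (sym (toℕ-injective
    (equidistant-unique (toℕ t) (toℕ (cyclicSuc t)) (λ e → u₁≢v₁ (toℕ-injective e))
      (equidistant-first (lower i) u₁ v₁ x₂ x₃ eq) (equidistant-first (upper i) u₁ v₁ x₂ x₃ eq′))))

module _ {n₁ n₂ n₃} {u v : Vertex n₁ n₂ n₃} where

  family₁⇒αM≤ : InjectiveFamily (Fin (pairCount n₁ n₂ n₃)) (ResolvingInF u v) →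
                αM n₁ n₂ n₃ ≤ numResolvingInF u v
  family₁⇒αM≤ fam = ≤-trans (≤-trans (m⊓n≤m _ _) (m⊓n≤m _ _)) (family-≤-numResolvingInF fam)

  family₂⇒αM≤ : InjectiveFamily (Fin (pairCount n₂ n₃ n₁)) (ResolvingInF u v) →
                αM n₁ n₂ n₃ ≤ numResolvingInF u v
  family₂⇒αM≤ fam = ≤-trans αM≤pairCount₂ (family-≤-numResolvingInF fam)
    where
    αM≤pairCount₂ : αM n₁ n₂ n₃ ≤ pairCount n₂ n₃ n₁
    αM≤pairCount₂ = ≤-trans (m⊓n≤m _ _)
      (≤-trans (m⊓n≤n _ _) (≤-reflexive (cong (λ m → n₂ * (m ∸ 2)) (+-comm n₁ n₃))))

  family₃⇒αM≤ : InjectiveFamily (Fin (pairCount n₃ n₁ n₂)) (ResolvingInF u v) →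
                αM n₁ n₂ n₃ ≤ numResolvingInF u v
  family₃⇒αM≤ fam = ≤-trans (m⊓n≤n _ _) (family-≤-numResolvingInF fam)

αM≤numResolvingInF : ∀ {a b c} (u v : Vertex (suc (suc a)) (suc (suc b)) (suc (suc c))) → u ≢ v →
                     αM (suc (suc a)) (suc (suc b)) (suc (suc c)) ≤ numResolvingInF u v
αM≤numResolvingInF (u₁ , u₂ , u₃) (v₁ , v₂ , v₃) u≢v
  with u₁ ≟ᶠ v₁ | u₂ ≟ᶠ v₂ | u₃ ≟ᶠ v₃
... | yes refl | yes refl | yes refl = contradiction refl u≢v
... | _        | no u₂≢v₂ | no u₃≢v₃ =
  family₁⇒αM≤ (tailDiffers-family (u₁ , u₂ , u₃) (v₁ , v₂ , v₃) u₂≢v₂ u₃≢v₃)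
... | no u₁≢v₁ | yes refl | yes refl =
  family₁⇒αM≤ (headDiffers-family u₁ v₁ u₂ u₃ u₁≢v₁)
... | no u₁≢v₁ | yes refl | no u₃≢v₃ =
  family₂⇒αM≤ (rotate-family (rotate-family
    (tailDiffers-family (u₂ , u₃ , u₁) (v₂ , v₃ , v₁) u₃≢v₃ u₁≢v₁)))
... | yes refl | no u₂≢v₂ | yes refl =
  family₂⇒αM≤ (rotate-family (rotate-family (headDiffers-family u₂ v₂ u₃ u₁ u₂≢v₂)))
... | no u₁≢v₁ | no u₂≢v₂ | yes refl =
  family₃⇒αM≤ (rotate-family (tailDiffers-family (u₃ , u₁ , u₂) (v₃ , v₁ , v₂) u₁≢v₁ u₂≢v₂))
... | yes refl | yes refl | no u₃≢v₃ =
  family₃⇒αM≤ (rotate-family (headDiffers-family u₃ v₃ u₁ u₂ u₃≢v₃))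

proposition12 : (n₁ n₂ n₃ : ℕ) → 2 ≤ n₁ → 2 ≤ n₂ → 2 ≤ n₃ →
                (u v : Vertex n₁ n₂ n₃) → u ≢ v →
                αM n₁ n₂ n₃ ≤ numResolvingInF u v
proposition12 _ _ _ (s≤s (s≤s _)) (s≤s (s≤s _)) (s≤s (s≤s _)) = αM≤numResolvingInF
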